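{- For all positive integers $m,k$, with $m=\binom{n_k}{k}+\binom{n_{k-1}}{k-1}+\sum_{i=1}^t\binom{a_{k-i}}{k-i}$ the representation described below, $$\mathrm{CON}_k(m)\ge\binom{n_k}{k+1}+\binom{n_{k-1}}{k}+\binom{a_{k-1}}{k},$$ where the last term is $0$ if $t=0$.
   Context: $c_i(G)$ is the number of $i$-vertex cliques of a graph $G$; $\binom{n}{l}=0$ if $l>n$ or $l<0$. The representation is the unique one with $t\ge0$, $n_k>n_{k-1}\ge k-2$, $a_{k-1}>\dots>a_{k-t}\ge k-t>0$ and $\binom{n_{k-1}}{k-2}>\sum_{i=1}^t\binom{a_{k-i}}{k-i}$ ($n_k$ is also the leading term of the canonical representation $m=\sum\binom{n_{k-i}}{k-i}$, $n_k>n_{k-1}>\dots$). $\mathrm{CON}_k(m)$ is the largest number of $(k+1)$-cliques that a finite simple graph with exactly $m$ $k$-cliques and at least one clique on $n_k$ vertices can have. -}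

module Defs where

open import Data.Bool using (Bool; true; false)
open import Data.Nat using (ℕ; zero; suc; _+_; _∸_; _≟_)
open import Data.Nat.Combinatorics using (_C_)
open import Data.Integer using (ℤ; +_; -[1+_])
open import Data.Fin using (Fin)
import Data.Fin.Properties as FinP
open import Data.Fin.Subset using (Subset; _∈_; ∣_∣; inside; outside)
open import Data.Fin.Subset.Properties using (_∈?_)
open import Data.Vec using ([]; _∷_)
open import Data.List using (List; [_]; _++_; map; filter; length)
open import Relation.Binary.PropositionalEquality using (_≡_)
open import Relation.Nullary using (¬_; Dec; ¬?)
open import Relation.Nullary.Decidable using (_×-dec_; _→-dec_)

record Graph : Set where
  field
    n      : ℕ
    adj    : Fin n → Fin n → Bool
    sym    : ∀ i j → adj i j ≡ adj j i
    irrefl : ∀ i → adj i i ≡ false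
open Graph public

IsClique : (G : Graph) → Subset (n G) → Set
IsClique G S = ∀ i j → i ∈ S → j ∈ S → ¬ (i ≡ j) → adj G i j ≡ true

isClique? : (G : Graph) → (S : Subset (n G)) → Dec (IsClique G S)
isClique? G S =
  FinP.all? λ i → FinP.all? λ j →
    (i ∈? S) →-dec ((j ∈? S) →-dec (¬? (i FinP.≟ j) →-dec Data.Bool._≟_ (adj G i j) true))
  where import Data.Bool

subsets : (k : ℕ) → List (Subset k)
subsets zero    = [ [] ]
subsets (suc k) = map (outside ∷_) (subsets k) ++ map (inside ∷_) (subsets k)

c : ℕ → Graph → ℕ
c i G = length (filter (λ S → (∣ S ∣ ≟ i) ×-dec isClique? G S) (subsets (n G)))

-- Binomial coefficient with integer arguments; zero if l > n or l < 0.
binom : ℤ → ℤ → ℕ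
binom (+ a)    (+ l)    = a C l
binom (+ a)    -[1+ _ ] = 0
binom -[1+ _ ] _        = 0

-- sumA k t a = Σ_{i=1}^{t} binom(a i, k - i), where a i stands for a_{k-i}.
sumA : ℕ → ℕ → (ℕ → ℕ) → ℕ
sumA k zero    a = 0
sumA k (suc t) a = sumA k t a + a (suc t) C (k ∸ suc t)

lastTerm : ℕ → ℕ → (ℕ → ℕ) → ℕ
lastTerm k zero    a = 0
lastTerm k (suc t) a = a 1 C k

module Submission where

-- Write m = C(n_k,k) + C(n_{k-1},k-1) + S with S = Σ C(a_{k-i},k-i).
-- Take the complete graph K_{n_k} and attach "cone" vertices, pairwise
-- non-adjacent, each joined to an initial segment of K_{n_k}: a cone vertex
-- of degree d ≤ n_k lies in exactly C(d,i) cliques of size i+1.  Cones of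
-- degree n_{k-1} and a_{k-1} (if t ≥ 1) produce C(n_{k-1},k-1) + C(a_{k-1},k-1)
-- k-cliques and C(n_{k-1},k) + C(a_{k-1},k) (k+1)-cliques; the missing
-- S - C(a_{k-1},k-1) k-cliques are supplied by cones of degree k-1, each
-- adding one k-clique and no (k+1)-clique.

open import Defs hiding (sym)
open import Data.Bool using (Bool; true; false)
open import Data.Nat using (ℕ; zero; suc; _+_; _∸_; _≤_; _<_; _≟_; z≤n; s≤s; _≤′_; ≤′-refl; ≤′-step)
open import Data.Nat.Properties
open import Data.Nat.Combinatorics using (_C_; nCk+nC[k+1]≡[n+1]C[k+1]; nCn≡1; k>n⇒nCk≡0)
open import Data.Nat.ListAction using (sum)
open import Data.Nat.ListAction.Properties using (sum-++)
open import Data.Integer using (ℤ; +_; -[1+_]; _-_; +≤+; +<+) renaming (_≤_ to _≤ℤ_; _<_ to _<ℤ_)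
open import Data.Fin using (Fin; zero; suc)
open import Data.Fin.Properties using () renaming (suc-injective to Fin-suc-injective)
open import Data.Fin.Subset using (Subset; ∣_∣; _∈_; _⊆_; _∩_; ⊤; inside; outside)
open import Data.Fin.Subset.Properties using (_⊆?_; ∈⊤; x∈p∩q⁺; x∈p∩q⁻; ∩-identityˡ; ∩-identityʳ; ∣⊤∣≡n)
open import Data.Vec using ([]; _∷_; lookup; here; there)
open import Data.Vec.Properties using (lookup-replicate; []=⇒lookup; lookup⇒[]=)
open import Data.List using (List; []; _∷_; [_]; _++_; map; filter; length; replicate)
open import Data.List.Properties using (filter-++; filter-≐; filter-none; length-++; map-++)
open import Data.List.Relation.Unary.All using (All; []; _∷_; universal)
open import Data.List.Relation.Unary.All.Properties using (++⁺; replicate⁺)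
open import Data.Product using (Σ; ∃; _×_; _,_; proj₁; proj₂)
open import Data.Empty using (⊥-elim)
open import Function using (_∘_)
open import Relation.Binary.PropositionalEquality using (_≡_; refl; sym; trans; cong; cong₂; subst; module ≡-Reasoning)
open import Relation.Nullary using (¬_; yes; no)
open import Relation.Nullary.Decidable using (_×-dec_)
open import Relation.Unary using (Decidable)

length-filter-map : {A B : Set} {P : A → Set} (P? : Decidable P) (f : B → A) (xs : List B) →
  length (filter P? (map f xs)) ≡ length (filter (P? ∘ f) xs)
length-filter-map P? f [] = refl
length-filter-map P? f (x ∷ xs) with P? (f x)
... | yes _ = cong suc (length-filter-map P? f xs)
... | no _  = length-filter-map P? f xs

count-subsets-suc : ∀ {m} {P : Subset (suc m) → Set} (P? : Decidable P) →
  length (filter P? (subsets (suc m)))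
    ≡ length (filter (P? ∘ (outside ∷_)) (subsets m)) + length (filter (P? ∘ (inside ∷_)) (subsets m))
count-subsets-suc {m} P? = begin
  length (filter P? (map (outside ∷_) (subsets m) ++ map (inside ∷_) (subsets m)))
    ≡⟨ cong length (filter-++ P? (map (outside ∷_) (subsets m)) _) ⟩
  length (filter P? (map (outside ∷_) (subsets m)) ++ filter P? (map (inside ∷_) (subsets m)))
    ≡⟨ length-++ (filter P? (map (outside ∷_) (subsets m))) ⟩
  length (filter P? (map (outside ∷_) (subsets m))) + length (filter P? (map (inside ∷_) (subsets m)))
    ≡⟨ cong₂ _+_ (length-filter-map P? (outside ∷_) (subsets m)) (length-filter-map P? (inside ∷_) (subsets m)) ⟩
  length (filter (P? ∘ (outside ∷_)) (subsets m)) + length (filter (P? ∘ (inside ∷_)) (subsets m))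
    ∎
  where open ≡-Reasoning

count-none : ∀ {m} {P : Subset m → Set} (P? : Decidable P) → (∀ S → ¬ P S) →
  length (filter P? (subsets m)) ≡ 0
count-none {m} P? none = cong length (filter-none P? (universal none (subsets m)))

CliqueIn : ℕ → (G : Graph) → Subset (n G) → Subset (n G) → Set
CliqueIn i G P S = ∣ S ∣ ≡ i × S ⊆ P × IsClique G S

cliqueIn? : ∀ i G P → Decidable (CliqueIn i G P)
cliqueIn? i G P S = (∣ S ∣ ≟ i) ×-dec ((S ⊆? P) ×-dec isClique? G S)

cliquesIn : ℕ → (G : Graph) → Subset (n G) → ℕ
cliquesIn i G P = length (filter (cliqueIn? i G P) (subsets (n G)))

c≡cliquesIn⊤ : ∀ i G → c i G ≡ cliquesIn i G ⊤
c≡cliquesIn⊤ i G = cong length (filter-≐ _ (cliqueIn? i G ⊤)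
  ((λ (size , cl) → size , (λ _ → ∈⊤) , cl) , (λ (size , _ , cl) → size , cl)) (subsets (n G)))

addVertex : (G : Graph) → Subset (n G) → Graph
addVertex G N = record { n = suc (n G) ; adj = adj′ ; sym = sym′ ; irrefl = irrefl′ }
  where
  adj′ : Fin (suc (n G)) → Fin (suc (n G)) → Bool
  adj′ zero    zero    = false
  adj′ zero    (suc j) = lookup N j
  adj′ (suc i) zero    = lookup N i
  adj′ (suc i) (suc j) = adj G i j
  sym′ : ∀ i j → adj′ i j ≡ adj′ j i
  sym′ zero    zero    = refl
  sym′ zero    (suc j) = refl
  sym′ (suc i) zero    = refl
  sym′ (suc i) (suc j) = Graph.sym G i j
  irrefl′ : ∀ i → adj′ i i ≡ false
  irrefl′ zero    = refl
  irrefl′ (suc i) = irrefl G i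

-- The number of i-cliques through the new vertex whose other vertices lie
-- in a set Q: the (i-1)-cliques in Q (none for i = 0).
cliquesWithApex : ℕ → (G : Graph) → Subset (n G) → ℕ
cliquesWithApex zero    G Q = 0
cliquesWithApex (suc i) G Q = cliquesIn i G Q

module _ (G : Graph) (N : Subset (n G)) where
  private
    G⁺ : Graph
    G⁺ = addVertex G N

    ∈-tail : ∀ {m} {x : Fin m} {b} {P : Subset m} → suc x ∈ (b ∷ P) → x ∈ P
    ∈-tail (there x∈P) = x∈P

    ∈-head : ∀ {m} {b} {P : Subset m} → zero ∈ (b ∷ P) → b ≡ true
    ∈-head here = refl

    restrict : ∀ {b} {S : Subset (n G)} → IsClique G⁺ (b ∷ S) → IsClique G S
    restrict cl i j i∈S j∈S i≢j = cl (suc i) (suc j) (there i∈S) (there j∈S) (i≢j ∘ Fin-suc-injective)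

    lift-outside : ∀ {S} → IsClique G S → IsClique G⁺ (outside ∷ S)
    lift-outside cl (suc i) (suc j) (there i∈S) (there j∈S) i≢j = cl i j i∈S j∈S (i≢j ∘ cong suc)

    lift-inside : ∀ {S} → IsClique G S → S ⊆ N → IsClique G⁺ (inside ∷ S)
    lift-inside cl S⊆N zero    zero    _           _           i≢j = ⊥-elim (i≢j refl)
    lift-inside cl S⊆N zero    (suc j) _           (there j∈S) _   = []=⇒lookup (S⊆N j∈S)
    lift-inside cl S⊆N (suc i) zero    (there i∈S) _           _   = []=⇒lookup (S⊆N i∈S)
    lift-inside cl S⊆N (suc i) (suc j) (there i∈S) (there j∈S) i≢j = cl i j i∈S j∈S (i≢j ∘ cong suc)

    outside-clique : ∀ i b P S → CliqueIn i G⁺ (b ∷ P) (outside ∷ S) → CliqueIn i G P S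
    outside-clique i b P S (size , sub , cl) = size , ∈-tail ∘ sub ∘ there , restrict cl

    outside-clique⁻¹ : ∀ i b P S → CliqueIn i G P S → CliqueIn i G⁺ (b ∷ P) (outside ∷ S)
    outside-clique⁻¹ i b P S (size , sub , cl) = size , sub′ , lift-outside cl
      where
      sub′ : (outside ∷ S) ⊆ (b ∷ P)
      sub′ (there x∈S) = there (sub x∈S)

    inside-clique : ∀ i b P S → CliqueIn (suc i) G⁺ (b ∷ P) (inside ∷ S) → b ≡ true × CliqueIn i G (P ∩ N) S
    inside-clique i b P S (size , sub , cl) = ∈-head (sub here) , suc-injective size , sub′ , restrict cl
      where
      sub′ : S ⊆ P ∩ N
      sub′ {x} x∈S = x∈p∩q⁺ (∈-tail (sub (there x∈S)) , lookup⇒[]= x N (cl zero (suc x) here (there x∈S) (λ ())))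

    inside-clique⁻¹ : ∀ i P S → CliqueIn i G (P ∩ N) S → CliqueIn (suc i) G⁺ (inside ∷ P) (inside ∷ S)
    inside-clique⁻¹ i P S (size , sub , cl) = cong suc size , sub′ , lift-inside cl (proj₂ ∘ x∈p∩q⁻ P N ∘ sub)
      where
      sub′ : (inside ∷ S) ⊆ (inside ∷ P)
      sub′ here        = here
      sub′ (there x∈S) = there (proj₁ (x∈p∩q⁻ P N (sub x∈S)))

    no-apex-outside : ∀ i P S → ¬ CliqueIn i G⁺ (outside ∷ P) (inside ∷ S)
    no-apex-outside zero    P S (() , _)
    no-apex-outside (suc i) P S q with () ← proj₁ (inside-clique i outside P S q)

    no-apex-in-empty : ∀ P S → ¬ CliqueIn 0 G⁺ P (inside ∷ S)
    no-apex-in-empty P S (() , _)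

    old-cliques : ∀ i b P →
      length (filter (cliqueIn? i G⁺ (b ∷ P) ∘ (outside ∷_)) (subsets (n G))) ≡ cliquesIn i G P
    old-cliques i b P = cong length (filter-≐ _ (cliqueIn? i G P)
      (outside-clique i b P _ , outside-clique⁻¹ i b P _) (subsets (n G)))

    apex-cliques : ∀ i P →
      length (filter (cliqueIn? i G⁺ (inside ∷ P) ∘ (inside ∷_)) (subsets (n G))) ≡ cliquesWithApex i G (P ∩ N)
    apex-cliques zero    P = count-none _ (no-apex-in-empty (inside ∷ P))
    apex-cliques (suc i) P = cong length (filter-≐ _ (cliqueIn? i G (P ∩ N))
      (proj₂ ∘ inside-clique i true P _ , inside-clique⁻¹ i P _) (subsets (n G)))

  cliquesIn-outside : ∀ i P → cliquesIn i (addVertex G N) (outside ∷ P) ≡ cliquesIn i G P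
  cliquesIn-outside i P = begin
    cliquesIn i G⁺ (outside ∷ P)
      ≡⟨ count-subsets-suc (cliqueIn? i G⁺ (outside ∷ P)) ⟩
    length (filter (cliqueIn? i G⁺ (outside ∷ P) ∘ (outside ∷_)) (subsets (n G)))
      + length (filter (cliqueIn? i G⁺ (outside ∷ P) ∘ (inside ∷_)) (subsets (n G)))
      ≡⟨ cong₂ _+_ (old-cliques i outside P) (count-none _ (no-apex-outside i P)) ⟩
    cliquesIn i G P + 0
      ≡⟨ +-identityʳ _ ⟩
    cliquesIn i G P
      ∎
    where open ≡-Reasoning

  cliquesIn-inside : ∀ i P → cliquesIn i (addVertex G N) (inside ∷ P) ≡ cliquesIn i G P + cliquesWithApex i G (P ∩ N)
  cliquesIn-inside i P = trans (count-subsets-suc (cliqueIn? i G⁺ (inside ∷ P)))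
    (cong₂ _+_ (old-cliques i inside P) (apex-cliques i P))

  clique-outside : ∀ {S} → IsClique G S → IsClique (addVertex G N) (outside ∷ S)
  clique-outside = lift-outside

K : ℕ → Graph
K zero    = record { n = 0 ; adj = λ () ; sym = λ () ; irrefl = λ () }
K (suc p) = addVertex (K p) ⊤

-- K p has p vertices (propositionally, since n is built up by recursion).
n-K : ∀ p → n (K p) ≡ p
n-K zero    = refl
n-K (suc p) = cong suc (n-K p)

K-clique : ∀ p S → IsClique (K p) S
K-clique p S i j _ _ = adjacent p i j
  where
  adjacent : ∀ p (i j : Fin (n (K p))) → ¬ i ≡ j → adj (K p) i j ≡ true
  adjacent (suc p) zero    zero    i≢j = ⊥-elim (i≢j refl)
  adjacent (suc p) zero    (suc j) _   = lookup-replicate j true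
  adjacent (suc p) (suc i) zero    _   = lookup-replicate i true
  adjacent (suc p) (suc i) (suc j) i≢j = adjacent p i j (i≢j ∘ cong suc)

-- A set of s vertices of a complete graph contains C(s,i) cliques of size i
-- (Pascal's rule, splitting on the last added vertex).
cliquesIn-K : ∀ p i (P : Subset (n (K p))) → cliquesIn i (K p) P ≡ ∣ P ∣ C i
cliquesIn-K zero    zero    []            = refl
cliquesIn-K zero    (suc i) []            = refl
cliquesIn-K (suc p) i       (outside ∷ P) = trans (cliquesIn-outside (K p) ⊤ i P) (cliquesIn-K p i P)
cliquesIn-K (suc p) zero    (inside ∷ P)  =
  trans (cliquesIn-inside (K p) ⊤ 0 P) (trans (+-identityʳ _) (cliquesIn-K p 0 P))
cliquesIn-K (suc p) (suc i) (inside ∷ P)  = begin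
  cliquesIn (suc i) (K (suc p)) (inside ∷ P)
    ≡⟨ cliquesIn-inside (K p) ⊤ (suc i) P ⟩
  cliquesIn (suc i) (K p) P + cliquesIn i (K p) (P ∩ ⊤)
    ≡⟨ cong₂ _+_ (cliquesIn-K p (suc i) P) (trans (cong (cliquesIn i (K p)) (∩-identityʳ P)) (cliquesIn-K p i P)) ⟩
  ∣ P ∣ C suc i + ∣ P ∣ C i
    ≡⟨ +-comm (∣ P ∣ C suc i) _ ⟩
  ∣ P ∣ C i + ∣ P ∣ C suc i
    ≡⟨ nCk+nC[k+1]≡[n+1]C[k+1] ∣ P ∣ i ⟩
  suc ∣ P ∣ C suc i
    ∎
  where open ≡-Reasoning

prefix : ℕ → (m : ℕ) → Subset m
prefix d       zero    = []
prefix zero    (suc m) = outside ∷ prefix zero m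
prefix (suc d) (suc m) = inside ∷ prefix d m

∣prefix∣ : ∀ d m → d ≤ m → ∣ prefix d m ∣ ≡ d
∣prefix∣ zero    zero    _         = refl
∣prefix∣ zero    (suc m) _         = ∣prefix∣ zero m z≤n
∣prefix∣ (suc d) (suc m) (s≤s d≤m) = cong suc (∣prefix∣ d m d≤m)

mutual
  coneGraph : ℕ → List ℕ → Graph
  coneGraph nk []       = K nk
  coneGraph nk (d ∷ ds) = addVertex (coneGraph nk ds) (basePrefix nk ds d)

  basePrefix : ∀ nk ds → ℕ → Subset (n (coneGraph nk ds))
  basePrefix nk []       d = prefix d (n (K nk))
  basePrefix nk (_ ∷ ds) d = outside ∷ basePrefix nk ds d

∣basePrefix∣ : ∀ nk ds d → d ≤ nk → ∣ basePrefix nk ds d ∣ ≡ d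
∣basePrefix∣ nk []       d d≤nk = ∣prefix∣ d (n (K nk)) (subst (d ≤_) (sym (n-K nk)) d≤nk)
∣basePrefix∣ nk (_ ∷ ds) d d≤nk = ∣basePrefix∣ nk ds d d≤nk

basePrefix-clique : ∀ nk ds d → IsClique (coneGraph nk ds) (basePrefix nk ds d)
basePrefix-clique nk []       d = K-clique nk _
basePrefix-clique nk (e ∷ ds) d = clique-outside (coneGraph nk ds) (basePrefix nk ds e) (basePrefix-clique nk ds d)

cliquesIn-basePrefix : ∀ nk ds d i → d ≤ nk → cliquesIn i (coneGraph nk ds) (basePrefix nk ds d) ≡ d C i
cliquesIn-basePrefix nk []       d i d≤nk = trans (cliquesIn-K nk i _) (cong (_C i) (∣basePrefix∣ nk [] d d≤nk))
cliquesIn-basePrefix nk (e ∷ ds) d i d≤nk =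
  trans (cliquesIn-outside (coneGraph nk ds) (basePrefix nk ds e) i _) (cliquesIn-basePrefix nk ds d i d≤nk)

c-coneGraph : ∀ nk ds i → All (_≤ nk) ds → c (suc i) (coneGraph nk ds) ≡ nk C suc i + sum (map (_C i) ds)
c-coneGraph nk ds i degrees = trans (c≡cliquesIn⊤ (suc i) (coneGraph nk ds)) (count ds degrees)
  where
  open ≡-Reasoning
  count : ∀ ds → All (_≤ nk) ds → cliquesIn (suc i) (coneGraph nk ds) ⊤ ≡ nk C suc i + sum (map (_C i) ds)
  count [] [] = begin
    cliquesIn (suc i) (K nk) ⊤ ≡⟨ cliquesIn-K nk (suc i) ⊤ ⟩
    ∣ ⊤ {n (K nk)} ∣ C suc i   ≡⟨ cong (_C suc i) (trans (∣⊤∣≡n (n (K nk))) (n-K nk)) ⟩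
    nk C suc i                 ≡⟨ +-identityʳ _ ⟨
    nk C suc i + 0             ∎
  count (d ∷ ds) (d≤nk ∷ degrees) = begin
    cliquesIn (suc i) (coneGraph nk (d ∷ ds)) ⊤
      ≡⟨ cliquesIn-inside (coneGraph nk ds) (basePrefix nk ds d) (suc i) ⊤ ⟩
    cliquesIn (suc i) (coneGraph nk ds) ⊤ + cliquesIn i (coneGraph nk ds) (⊤ ∩ basePrefix nk ds d)
      ≡⟨ cong₂ _+_ (count ds degrees)
           (trans (cong (cliquesIn i (coneGraph nk ds)) (∩-identityˡ _)) (cliquesIn-basePrefix nk ds d i d≤nk)) ⟩
    nk C suc i + sum (map (_C i) ds) + d C i
      ≡⟨ +-assoc (nk C suc i) _ _ ⟩
    nk C suc i + (sum (map (_C i) ds) + d C i)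
      ≡⟨ cong (_+_ (nk C suc i)) (+-comm (sum (map (_C i) ds)) (d C i)) ⟩
    nk C suc i + (d C i + sum (map (_C i) ds))
      ∎

coneGraph-clique : ∀ nk ds → ∃ λ (S : Subset (n (coneGraph nk ds))) → ∣ S ∣ ≡ nk × IsClique (coneGraph nk ds) S
coneGraph-clique nk ds = basePrefix nk ds nk , ∣basePrefix∣ nk ds nk ≤-refl , basePrefix-clique nk ds nk

sum-padding : ∀ k r → sum (map (_C k) (replicate r k)) ≡ r
sum-padding k zero    = refl
sum-padding k (suc r) = cong₂ _+_ (nCn≡1 k) (sum-padding k r)

sum-padding-next : ∀ k r → sum (map (_C suc k) (replicate r k)) ≡ 0
sum-padding-next k zero    = refl
sum-padding-next k (suc r) = cong₂ _+_ (k>n⇒nCk≡0 (n<1+n k)) (sum-padding-next k r)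

padded-cone : ∀ nk k ds T → All (_≤ nk) ds → k ≤ nk → sum (map (_C k) ds) ≤ T →
  Σ Graph λ G →
    c (suc k) G ≡ nk C suc k + T ×
    c (suc (suc k)) G ≡ nk C suc (suc k) + sum (map (_C suc k) ds) ×
    (∃ λ (S : Subset (n G)) → ∣ S ∣ ≡ nk × IsClique G S)
padded-cone nk k ds T degrees k≤nk bound =
  coneGraph nk degs , count-k , count-k+1 , coneGraph-clique nk degs
  where
  open ≡-Reasoning
  r : ℕ
  r = T ∸ sum (map (_C k) ds)
  degs : List ℕ
  degs = ds ++ replicate r k
  sum-degs : ∀ j → sum (map (_C j) degs) ≡ sum (map (_C j) ds) + sum (map (_C j) (replicate r k))
  sum-degs j = trans (cong sum (map-++ (_C j) ds _)) (sum-++ (map (_C j) ds) _)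
  count-k : c (suc k) (coneGraph nk degs) ≡ nk C suc k + T
  count-k = begin
    c (suc k) (coneGraph nk degs)
      ≡⟨ c-coneGraph nk degs k (++⁺ degrees (replicate⁺ r k≤nk)) ⟩
    nk C suc k + sum (map (_C k) degs)
      ≡⟨ cong (_+_ (nk C suc k)) (trans (sum-degs k) (cong (_+_ (sum (map (_C k) ds))) (sum-padding k r))) ⟩
    nk C suc k + (sum (map (_C k) ds) + r)
      ≡⟨ cong (_+_ (nk C suc k)) (m+[n∸m]≡n bound) ⟩
    nk C suc k + T
      ∎
  count-k+1 : c (suc (suc k)) (coneGraph nk degs) ≡ nk C suc (suc k) + sum (map (_C suc k) ds)
  count-k+1 = begin
    c (suc (suc k)) (coneGraph nk degs)
      ≡⟨ c-coneGraph nk degs (suc k) (++⁺ degrees (replicate⁺ r k≤nk)) ⟩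
    nk C suc (suc k) + sum (map (_C suc k) degs)
      ≡⟨ cong (_+_ (nk C suc (suc k))) (trans (sum-degs (suc k)) (cong (_+_ (sum (map (_C suc k) ds))) (sum-padding-next k r))) ⟩
    nk C suc (suc k) + (sum (map (_C suc k) ds) + 0)
      ≡⟨ cong (_+_ (nk C suc (suc k))) (+-identityʳ _) ⟩
    nk C suc (suc k) + sum (map (_C suc k) ds)
      ∎

-- C(n,k) is monotone in n (by Pascal's rule, C(n,k) ≤ C(n+1,k)).
C-monoˡ : ∀ {m n} k → m ≤ n → m C k ≤ n C k
C-monoˡ k m≤n = go (≤⇒≤′ m≤n)
  where
  C-suc : ∀ n k → n C k ≤ suc n C k
  C-suc n zero    = ≤-refl
  C-suc n (suc k) = subst (n C suc k ≤_) (nCk+nC[k+1]≡[n+1]C[k+1] n k) (m≤n+m (n C suc k) (n C k))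
  go : ∀ {m n} → m ≤′ n → m C k ≤ n C k
  go ≤′-refl                = ≤-refl
  go {n = suc n} (≤′-step le) = ≤-trans (go le) (C-suc n k)

-- If C(b,j+1) < C(p,j) then b ≤ p: otherwise C(p,j) ≤ C(p+1,j+1) ≤ C(b,j+1).
degree-bound : ∀ b p j → b C suc j < p C j → b ≤ p
degree-bound b p j lt with b ≤? p
... | yes b≤p = b≤p
... | no  b≰p = ⊥-elim (≤⇒≯ (≤-trans pascal (C-monoˡ (suc j) (≰⇒> b≰p))) lt)
  where
  pascal : p C j ≤ suc p C suc j
  pascal = subst (p C j ≤_) (nCk+nC[k+1]≡[n+1]C[k+1] p j) (m≤m+n (p C j) (p C suc j))

-- From k-2 ≤ n_{k-1} < n_k: cones of degree k-1 fit into K_{n_k}.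
order-bound : ∀ k p nk → (+ suc k - + 2) ≤ℤ + p → p < nk → k ≤ nk
order-bound zero    p nk _          _    = z≤n
order-bound (suc j) p nk (+≤+ j≤p) p<nk = ≤-trans (s≤s j≤p) p<nk

-- From C(b,k) ≤ S < C(n_{k-1},k-2): the degree b = a_{k-1} is at most n_{k-1}.
top-degree-bound : ∀ k p b S → b C k ≤ S → S < binom (+ p) (+ suc k - + 2) → b ≤ p
top-degree-bound zero    p b S _   ()
top-degree-bound (suc j) p b S b≤S S<C = degree-bound b p j (≤-<-trans b≤S S<C)

sumA-first : ∀ k t a → a 1 C (k ∸ 1) ≤ sumA k (suc t) a
sumA-first k zero    a = ≤-refl
sumA-first k (suc t) a = ≤-trans (sumA-first k t a) (m≤m+n _ _)

-- Lemma 4.2.  In the proof the order is written suc k.  If n_{k-1} < 0 then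
-- the order is 1, t = 0, and K_{n_k} alone suffices; otherwise the prescribed
-- cones have degree n_{k-1}, plus a_{k-1} when t ≥ 1, and padding cones of
-- degree k supply the rest of S.
lemma4p2 : (m k : ℕ) → 1 ≤ m → 1 ≤ k →
    (nk : ℕ) (nk1 : ℤ) (t : ℕ) (a : ℕ → ℕ) →
    nk1 <ℤ + nk →
    (+ k - + 2) ≤ℤ nk1 →
    (∀ i → 1 ≤ i → i < t → a (suc i) < a i) →
    (1 ≤ t → k ∸ t ≤ a t) →
    t < k →
    sumA k t a < binom nk1 (+ k - + 2) →
    m ≡ nk C k + binom nk1 (+ k - + 1) + sumA k t a →
    Σ Graph λ G →
      c k G ≡ m ×
      (∃ λ (S : Subset (n G)) → ∣ S ∣ ≡ nk × IsClique G S) ×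
      nk C suc k + binom nk1 (+ k) + lastTerm k t a ≤ c (suc k) G
lemma4p2 m zero _ () _ _ _ _ _ _ _ _ _ _ _
lemma4p2 m (suc (suc k)) _ _ nk -[1+ _ ] t a _ () _ _ _ _ _
lemma4p2 m (suc zero) _ _ nk -[1+ _ ] (suc t) a _ _ _ _ (s≤s ()) _ _
lemma4p2 m (suc zero) _ _ nk -[1+ _ ] zero a _ _ _ _ _ _ m≡ =
  let (G , count-1 , count-2 , clique) = padded-cone nk 0 [] 0 [] z≤n z≤n
  in G , trans count-1 (sym (trans m≡ (+-identityʳ _))) , clique ,
     ≤-reflexive (trans (+-identityʳ _) (sym count-2))
lemma4p2 m (suc k) _ _ nk (+ p) zero a (+<+ p<nk) k-2≤p _ _ _ _ m≡ =
  let (G , count-k , count-k+1 , clique) =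
        padded-cone nk k [ p ] (p C k) (<⇒≤ p<nk ∷ []) (order-bound k p nk k-2≤p p<nk) (≤-reflexive (+-identityʳ _))
  in G , trans count-k (sym (trans m≡ (+-identityʳ _))) , clique ,
     ≤-reflexive (trans (+-assoc _ (p C suc k) 0) (sym count-k+1))
lemma4p2 m (suc k) _ _ nk (+ p) (suc t) a (+<+ p<nk) k-2≤p _ _ _ S<C m≡ =
  let (G , count-k , count-k+1 , clique) =
        padded-cone nk k (p ∷ a 1 ∷ []) (p C k + S) (<⇒≤ p<nk ∷ ≤-trans a₁≤p (<⇒≤ p<nk) ∷ [])
          (order-bound k p nk k-2≤p p<nk) (+-monoʳ-≤ (p C k) (subst (_≤ S) (sym (+-identityʳ _)) a₁-term≤S))
  in G , trans count-k (sym (trans m≡ (+-assoc (nk C suc k) (p C k) S))) , clique ,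
     ≤-reflexive (trans (+-assoc (nk C suc (suc k)) (p C suc k) (a 1 C suc k))
       (trans (cong (λ x → nk C suc (suc k) + (p C suc k + x)) (sym (+-identityʳ (a 1 C suc k)))) (sym count-k+1)))
  where
  S : ℕ
  S = sumA (suc k) (suc t) a
  a₁-term≤S : a 1 C k ≤ S
  a₁-term≤S = sumA-first (suc k) t a
  a₁≤p : a 1 ≤ p
  a₁≤p = top-degree-bound k p (a 1) S a₁-term≤S S<C
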